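{- For every class $\mathcal F$ of (finite) graphs and every nonnegative integer $n$, the asymptotic dimension of $\mathcal F^{+n}$ equals the asymptotic dimension of $\mathcal F$.
   Context: All graphs are finite and simple. For a class $\mathcal F$ of graphs and integer $n\ge 0$, $\mathcal F^{+n}$ is the class of graphs $G$ for which there exists $Z\subseteq V(G)$ with $|Z|\le n$ and $G-Z\in\mathcal F$. A graph $G$ is regarded as the metric space $(V(G),d_G)$ with $d_G$ the shortest-path distance ($\infty$ between different components). For a (pseudo)metric space $(X,d)$, a family $\mathcal U$ of subsets of $X$ is $D$-bounded if each member has diameter at most $D$, and $r$-disjoint if $d(a,b)>r$ whenever $a,b$ lie in different members. A function $D_X:\mathbb{R}^+\to\mathbb{R}^+$ is an $n$-dimensional control function for $(X,d)$ if for every $r>0$ there is a cover $\mathcal U=\bigcup_{i=1}^{n+1}\mathcal U_i$ of $X$ with each $\mathcal U_i$ $r$-disjoint and each member of $\mathcal U$ $D_X(r)$-bounded. The asymptotic dimension of a family of spaces is the least $n$ for which a single function is an $n$-dimensional control function for every member ($\infty$ if none exists). -}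

module Defs where

open import Data.Nat using (ℕ; zero; suc; _≤_; _<_)
open import Data.Bool using (Bool; true)
open import Data.Fin using (Fin)
import Data.Fin as F
open import Data.Fin.Subset using (Subset; ∣_∣) renaming (_∈_ to _∈ₛ_; _∉_ to _∉ₛ_)
open import Data.List using (List)
open import Data.List.Membership.Propositional using (_∈_)
open import Data.Product using (Σ; ∃; ∃-syntax; _×_)
open import Function.Bundles using (_⇔_)
open import Relation.Binary.PropositionalEquality using (_≡_; _≢_)
open import Relation.Nullary using (¬_)
open import Data.Empty using (⊥)

record Graph : Set where
  field
    size  : ℕ
    adj   : Fin size → Fin size → Bool
    symm  : ∀ u v → adj u v ≡ adj v u
    irrefl : ∀ v → adj v v ≡ true → ⊥
open Graph public

GraphClass : Set₁
GraphClass = Graph → Set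

data Walk (G : Graph) : Fin (size G) → Fin (size G) → ℕ → Set where
  here : ∀ {u} → Walk G u u zero
  step : ∀ {u w v k} → adj G u w ≡ true → Walk G w v k → Walk G u v (suc k)

-- d_G(u,v) ≤ k   (false when u, v lie in different components)
DistLE : (G : Graph) → Fin (size G) → Fin (size G) → ℕ → Set
DistLE G u v k = ∃[ j ] (j ≤ k × Walk G u v j)

Bounded : (G : Graph) → ℕ → Subset (size G) → Set
Bounded G D S = ∀ u v → u ∈ₛ S → v ∈ₛ S → DistLE G u v D

Disjoint : (G : Graph) → ℕ → List (Subset (size G)) → Set
Disjoint G r fam = ∀ S T → S ∈ fam → T ∈ fam → S ≢ T →
  ∀ a b → a ∈ₛ S → b ∈ₛ T → ¬ DistLE G a b r

-- D is an m-dimensional control function for G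
-- (distances are integers, so it suffices to take r, D(r) ∈ ℕ)
IsControlFn : ℕ → (ℕ → ℕ) → Graph → Set
IsControlFn m D G = ∀ r → Σ (Fin (suc m) → List (Subset (size G))) λ fam →
    (∀ v → ∃[ i ] ∃[ S ] (S ∈ fam i × v ∈ₛ S))
  × (∀ i → Disjoint G r (fam i))
  × (∀ i S → S ∈ fam i → Bounded G (D r) S)

AsdimLE : GraphClass → ℕ → Set
AsdimLE 𝓕 m = ∃[ D ] (∀ G → 𝓕 G → IsControlFn m D G)

Induced : (G : Graph) {k : ℕ} → (Fin k → Fin (size G)) → Graph
Induced G {k} e = record
  { size = k
  ; adj = λ i j → adj G (e i) (e j)
  ; symm = λ i j → symm G (e i) (e j)
  ; irrefl = λ i → irrefl G (e i) }

-- G - Z, realised as the induced subgraph along the (unique) order-preserving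
-- enumeration e of V(G) ∖ Z
Deletion : (G : Graph) → Subset (size G) → (𝓕 : GraphClass) → Set
Deletion G Z 𝓕 = ∃[ k ] Σ (Fin k → Fin (size G)) λ e →
    (∀ i j → i F.< j → e i F.< e j)
  × (∀ v → (v ∉ₛ Z) ⇔ (∃[ i ] e i ≡ v))
  × 𝓕 (Induced G e)

Plus : GraphClass → ℕ → GraphClass
Plus 𝓕 n G = ∃[ Z ] (∣ Z ∣ ≤ n × Deletion G Z 𝓕)

-- The deleted vertices can be restored one at a time, each time enlarging the control function by
-- an amount depending only on r.  Suppose G − W has a cover by m + 1 colours of r-disjoint pieces
-- of diameter at most B in G, and put back a vertex z ∈ W.  Merge z, its r-ball in G − (W ∖ {z})
-- and every colour-0 piece meeting its 2r-ball into one new colour-0 piece, of diameter at most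
-- 2(2r + B); keep all other pieces.  A walk of length ≤ r between two pieces of one colour either
-- visits z, so that its end lies in the r-ball of z and was merged, or avoids z and was already
-- excluded; a walk of length ≤ r from the new piece into another colour-0 piece would make that
-- piece meet the 2r-ball of z.  After n steps the bound depends only on r, D(r) and n.

module Submission where

open import Defs
open import Data.Bool using (Bool; true; false)
import Data.Bool.Properties as Bool
open import Data.Empty using (⊥-elim)
open import Data.Fin using (Fin; zero; suc)
import Data.Fin as Fin
open import Data.Fin.Properties using (any?; <-cmp; <-irrefl; _≟_)
open import Data.Fin.Subset using (Subset; ∣_∣; ⊥; _-_) renaming (_∈_ to _∈ₛ_; _∉_ to _∉ₛ_)
open import Data.Fin.Subset.Properties
  using (_∈?_; nonempty?; ∉⊥; ∣⊥∣≡0; Empty-unique; x∈p∧x≢y⇒x∈p-y; x∈p⇒∣p-x∣<∣p∣)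
open import Data.List using (List; []; _∷_; map; allFin)
import Data.List.Properties as List
open import Data.List.Membership.Propositional using (_∈_)
open import Data.List.Membership.Propositional.Properties using (∈-map⁺; ∈-map⁻; ∈-allFin)
open import Data.Nat using (ℕ; zero; suc; _+_; _≤_; z≤n; s≤s)
open import Data.Nat.GeneralisedArithmetic using (iterate)
open import Data.Nat.Properties using (≤-refl; ≤-trans; <-≤-trans; ≤-pred; n≮0; m≤m+n; m≤n+m; n≤1+n)
open import Data.Product using (Σ; ∃-syntax; _×_; _,_; proj₁; proj₂)
open import Data.Sum using (_⊎_; inj₁; inj₂)
open import Data.Vec using (Vec; toList; tabulate)
open import Data.Vec.Properties
  using (toList-injective; cast-is-id; lookup⇒[]=; []=⇒lookup; lookup∘tabulate)
open import Function.Bundles using (_⇔_; mk⇔; Equivalence)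
open import Relation.Binary.Definitions using (tri<; tri≈; tri>)
open import Relation.Binary.PropositionalEquality using (_≡_; _≢_; refl; sym; trans; cong; subst)
open import Relation.Nullary using (¬_; Dec; yes; no; does; ¬?; _×-dec_; _⊎-dec_)
open import Relation.Nullary.Decidable using (dec-true)
open import Relation.Unary using (Decidable)

select : ∀ {n} {P : Fin n → Set} → Decidable P → Subset n
select P? = tabulate (λ x → does (P? x))

module _ {n} {P : Fin n → Set} (P? : Decidable P) where

  ∈-select⁺ : ∀ {x} → P x → x ∈ₛ select P?
  ∈-select⁺ {x} px = lookup⇒[]= x _ (trans (lookup∘tabulate _ x) (dec-true (P? x) px))

  ∈-select⁻ : ∀ {x} → x ∈ₛ select P? → P x
  ∈-select⁻ {x} x∈ = witness (P? x) (trans (sym (lookup∘tabulate _ x)) ([]=⇒lookup x∈))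
    where
    witness : ∀ {A : Set} (a? : Dec A) → does a? ≡ true → A
    witness (yes a) _ = a

strictlyIncreasing⇒injective : ∀ {k n} {e : Fin k → Fin n} →
  (∀ i j → i Fin.< j → e i Fin.< e j) → ∀ {i j} → e i ≡ e j → i ≡ j
strictlyIncreasing⇒injective increasing {i} {j} eq with <-cmp i j
... | tri< i<j _ _ = ⊥-elim (<-irrefl eq (increasing i j i<j))
... | tri≈ _ i≡j _ = i≡j
... | tri> _ _ j<i = ⊥-elim (<-irrefl (sym eq) (increasing j i j<i))

toList-injectiveₙ : ∀ {A : Set} {n} (xs ys : Vec A n) → toList xs ≡ toList ys → xs ≡ ys
toList-injectiveₙ xs ys eq = trans (sym (cast-is-id refl xs)) (toList-injective refl xs ys eq)

module _ (G : Graph) where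
  private
    V = Fin (size G)

  -- For u ∉ W, Reach W u v k says that d_{G − W}(u, v) ≤ k.
  data Reach (W : Subset (size G)) : V → V → ℕ → Set where
    stop : ∀ {u k} → Reach W u u k
    hop  : ∀ {u w v k} → adj G u w ≡ true → w ∉ₛ W → Reach W w v k → Reach W u v (suc k)

  reach? : ∀ W k u v → Dec (Reach W u v k)
  reach? W k u v with u ≟ v
  ... | yes refl = yes stop
  reach? W zero u v | no u≢v = no λ { stop → u≢v refl }
  reach? W (suc k) u v | no u≢v
    with any? (λ w → (adj G u w Bool.≟ true) ×-dec ¬? (w ∈? W) ×-dec reach? W k w v)
  ... | yes (w , uw , w∉W , wv) = yes (hop uw w∉W wv)
  ... | no ¬hop = no λ { stop → u≢v refl ; (hop {w = w} uw w∉W wv) → ¬hop (w , uw , w∉W , wv) }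

  Reach-mono : ∀ {W u v k l} → Reach W u v k → k ≤ l → Reach W u v l
  Reach-mono stop _ = stop
  Reach-mono (hop uw w∉W wv) (s≤s k≤l) = hop uw w∉W (Reach-mono wv k≤l)

  Reach-trans : ∀ {W u w v k l} → Reach W u w k → Reach W w v l → Reach W u v (k + l)
  Reach-trans {l = l} stop wv = Reach-mono wv (m≤n+m l _)
  Reach-trans (hop ux x∉W xw) wv = hop ux x∉W (Reach-trans xw wv)

  Reach-snoc : ∀ {W u w v k} → Reach W u w k → adj G w v ≡ true → v ∉ₛ W → Reach W u v (suc k)
  Reach-snoc stop wv v∉W = hop wv v∉W stop
  Reach-snoc (hop ux x∉W xw) wv v∉W = hop ux x∉W (Reach-snoc xw wv v∉W)

  Reach-sym : ∀ {W u v k} → u ∉ₛ W → Reach W u v k → Reach W v u k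
  Reach-sym u∉W stop = stop
  Reach-sym {u = u} u∉W (hop {w = w} uw w∉W wv) =
    Reach-snoc (Reach-sym w∉W wv) (trans (symm G w u) uw) u∉W

  Reach-through : ∀ {W W' z} → (∀ {x} → x ∈ₛ W → x ≢ z → x ∈ₛ W') →
    ∀ {u v k} → Reach W' u v k → Reach W' z v k ⊎ Reach W u v k
  Reach-through W⊆W'∪z stop = inj₂ stop
  Reach-through {z = z} W⊆W'∪z (hop {w = w} uw w∉W' wv) with w ≟ z
  ... | yes refl = inj₁ (Reach-mono wv (n≤1+n _))
  ... | no w≢z with Reach-through W⊆W'∪z wv
  ...   | inj₁ zv = inj₁ (Reach-mono zv (n≤1+n _))
  ...   | inj₂ wv′ = inj₂ (hop uw (λ w∈W → w∉W' (W⊆W'∪z w∈W w≢z)) wv′)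

  DistLE-mono : ∀ {u v k l} → DistLE G u v k → k ≤ l → DistLE G u v l
  DistLE-mono (j , j≤k , walk) k≤l = j , ≤-trans j≤k k≤l , walk

  DistLE-step : ∀ {u w v k} → adj G u w ≡ true → DistLE G w v k → DistLE G u v (suc k)
  DistLE-step uw (j , j≤k , walk) = suc j , s≤s j≤k , step uw walk

  Reach⇒DistLE : ∀ {W u v k} → Reach W u v k → DistLE G u v k
  Reach⇒DistLE stop = 0 , z≤n , here
  Reach⇒DistLE (hop uw _ wv) = DistLE-step uw (Reach⇒DistLE wv)

  DistLE⇒Reach : ∀ {u v k} → DistLE G u v k → Reach ⊥ u v k
  DistLE⇒Reach (j , j≤k , walk) = Reach-mono (fromWalk walk) j≤k
    where
    fromWalk : ∀ {u v j} → Walk G u v j → Reach ⊥ u v j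
    fromWalk here = stop
    fromWalk (step uw walk) = hop uw ∉⊥ (fromWalk walk)

  DistLE-sym : ∀ {u v k} → DistLE G u v k → DistLE G v u k
  DistLE-sym uv = Reach⇒DistLE (Reach-sym ∉⊥ (DistLE⇒Reach uv))

  DistLE-trans : ∀ {u w v k l} → DistLE G u w k → DistLE G w v l → DistLE G u v (k + l)
  DistLE-trans uw wv = Reach⇒DistLE (Reach-trans (DistLE⇒Reach uw) (DistLE⇒Reach wv))

  -- A cover of G − W: its pieces are the classes of vertices outside W with equal colour and
  -- label.  Pieces of one colour are r-disjoint in G − W, while diameters are measured in G.
  record LabelledCover (m : ℕ) (W : Subset (size G)) (r B : ℕ) : Set where
    field
      colour    : V → Fin (suc m)
      label     : V → List Bool
      separated : ∀ a b → a ∉ₛ W → b ∉ₛ W → colour a ≡ colour b → label a ≢ label b → ¬ Reach W a b r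
      bounded   : ∀ a b → a ∉ₛ W → b ∉ₛ W → colour a ≡ colour b → label a ≡ label b → DistLE G a b B

  LabelledCover-mono : ∀ {m W r B B'} → LabelledCover m W r B → B ≤ B' → LabelledCover m W r B'
  LabelledCover-mono c B≤B' = record
    { colour = colour ; label = label ; separated = separated
    ; bounded = λ a b a∉W b∉W ca≡cb la≡lb → DistLE-mono (bounded a b a∉W b∉W ca≡cb la≡lb) B≤B' }
    where open LabelledCover c

restoreBound : ℕ → ℕ → ℕ
restoreBound r B = (r + r + B) + (r + r + B)

B≤restoreBound : ∀ r B → B ≤ restoreBound r B
B≤restoreBound r B = ≤-trans (m≤n+m B (r + r)) (m≤m+n (r + r + B) (r + r + B))

≤-iterate : ∀ {f : ℕ → ℕ} → (∀ x → x ≤ f x) → ∀ x n → x ≤ iterate f x n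
≤-iterate x≤fx x zero = ≤-refl
≤-iterate x≤fx x (suc n) = ≤-trans (x≤fx x) (≤-iterate x≤fx _ n)

recolour : ∀ {m} {P : Set} → Dec P → Fin (suc m) → Fin (suc m)
recolour (yes _) _ = zero
recolour (no _) c = c

relabel : ∀ {P : Set} → Dec P → List Bool → List Bool
relabel (yes _) _ = true ∷ []
relabel (no _) l = false ∷ l

module _ {G : Graph} where
  private
    V = Fin (size G)

  module RestoreVertex {m W W' r B} (z : V) (W⊆W'∪z : ∀ {x} → x ∈ₛ W → x ≢ z → x ∈ₛ W')
                       (c : LabelledCover G m W r B) where
    open LabelledCover c

    outside : ∀ {x} → x ∉ₛ W' → x ≢ z → x ∉ₛ W
    outside x∉W' x≢z x∈W = x∉W' (W⊆W'∪z x∈W x≢z)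

    NearPiece : V → Set
    NearPiece v = Σ V λ u → u ∉ₛ W × colour u ≡ zero × label u ≡ label v × Reach G W' z u (r + r)

    Absorbed : V → Set
    Absorbed v = Reach G W' z v r ⊎ (colour v ≡ zero × NearPiece v)

    absorbed? : ∀ v → Dec (Absorbed v)
    absorbed? v = reach? G W' r z v ⊎-dec ((colour v ≟ zero) ×-dec nearPiece?)
      where
      nearPiece? : Dec (NearPiece v)
      nearPiece? = any? λ u → ¬? (u ∈? W) ×-dec (colour u ≟ zero)
        ×-dec List.≡-dec Bool._≟_ (label u) (label v) ×-dec reach? G W' (r + r) z u

    unabsorbed-outside : ∀ {v} → v ∉ₛ W' → ¬ Absorbed v → v ∉ₛ W
    unabsorbed-outside v∉W' ¬abs = outside v∉W' λ { refl → ¬abs (inj₁ stop) }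

    absorbed-near : ∀ {v} → v ∉ₛ W' → Absorbed v → DistLE G z v (r + r + B)
    absorbed-near v∉W' (inj₁ zv) =
      DistLE-mono G (Reach⇒DistLE G zv) (≤-trans (m≤m+n r r) (m≤m+n (r + r) B))
    absorbed-near {v} v∉W' (inj₂ (v₀ , u , u∉W , u₀ , lu≡lv , zu)) with v ≟ z
    ... | yes refl = 0 , z≤n , here
    ... | no v≢z = DistLE-trans G (Reach⇒DistLE G zu)
                     (bounded u v u∉W (outside v∉W' v≢z) (trans u₀ (sym v₀)) lu≡lv)

    absorbed-closed : ∀ {a b} → a ∉ₛ W' → b ∉ₛ W' → Absorbed a → colour b ≡ zero →
      Reach G W' a b r → Absorbed b
    absorbed-closed {a} {b} a∉W' b∉W' abs-a b₀ ab with a ≟ z | b ≟ z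
    ... | yes refl | _ = inj₁ ab
    ... | no _ | yes refl = inj₁ stop
    ... | no a≢z | no b≢z with abs-a
    ...   | inj₁ za = inj₂ (b₀ , b , outside b∉W' b≢z , b₀ , refl , Reach-trans G za ab)
    ...   | inj₂ (a₀ , u , u∉W , u₀ , lu≡la , zu) with Reach-through G W⊆W'∪z ab
    ...     | inj₁ zb = inj₁ zb
    ...     | inj₂ ab′ with List.≡-dec Bool._≟_ (label a) (label b)
    ...       | yes la≡lb = inj₂ (b₀ , u , u∉W , u₀ , trans lu≡la la≡lb , zu)
    ...       | no la≢lb = ⊥-elim (separated a b (outside a∉W' a≢z) (outside b∉W' b≢z)
                                     (trans a₀ (sym b₀)) la≢lb ab′)

    separated′ : ∀ a b (abs-a? : Dec (Absorbed a)) (abs-b? : Dec (Absorbed b)) → a ∉ₛ W' → b ∉ₛ W' →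
      recolour abs-a? (colour a) ≡ recolour abs-b? (colour b) →
      relabel abs-a? (label a) ≢ relabel abs-b? (label b) → ¬ Reach G W' a b r
    separated′ a b (yes _) (yes _) _ _ _ la≢lb _ = la≢lb refl
    separated′ a b (yes abs-a) (no ¬abs-b) a∉W' b∉W' 0≡cb _ ab =
      ¬abs-b (absorbed-closed a∉W' b∉W' abs-a (sym 0≡cb) ab)
    separated′ a b (no ¬abs-a) (yes abs-b) a∉W' b∉W' ca≡0 _ ab =
      ¬abs-a (absorbed-closed b∉W' a∉W' abs-b ca≡0 (Reach-sym G a∉W' ab))
    separated′ a b (no ¬abs-a) (no ¬abs-b) a∉W' b∉W' ca≡cb la≢lb ab with Reach-through G W⊆W'∪z ab
    ... | inj₁ zb = ¬abs-b (inj₁ zb)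
    ... | inj₂ ab′ = separated a b (unabsorbed-outside a∉W' ¬abs-a) (unabsorbed-outside b∉W' ¬abs-b)
                       ca≡cb (λ la≡lb → la≢lb (cong (false ∷_) la≡lb)) ab′

    bounded′ : ∀ a b (abs-a? : Dec (Absorbed a)) (abs-b? : Dec (Absorbed b)) → a ∉ₛ W' → b ∉ₛ W' →
      recolour abs-a? (colour a) ≡ recolour abs-b? (colour b) →
      relabel abs-a? (label a) ≡ relabel abs-b? (label b) → DistLE G a b (restoreBound r B)
    bounded′ a b (yes abs-a) (yes abs-b) a∉W' b∉W' _ _ =
      DistLE-trans G (DistLE-sym G (absorbed-near a∉W' abs-a)) (absorbed-near b∉W' abs-b)
    bounded′ a b (yes _) (no _) _ _ _ ()
    bounded′ a b (no _) (yes _) _ _ _ ()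
    bounded′ a b (no ¬abs-a) (no ¬abs-b) a∉W' b∉W' ca≡cb la≡lb =
      DistLE-mono G (bounded a b (unabsorbed-outside a∉W' ¬abs-a) (unabsorbed-outside b∉W' ¬abs-b)
                       ca≡cb (List.∷-injectiveʳ la≡lb)) (B≤restoreBound r B)

    cover : LabelledCover G m W' r (restoreBound r B)
    cover = record
      { colour = λ v → recolour (absorbed? v) (colour v)
      ; label = λ v → relabel (absorbed? v) (label v)
      ; separated = λ a b → separated′ a b (absorbed? a) (absorbed? b)
      ; bounded = λ a b → bounded′ a b (absorbed? a) (absorbed? b) }

  restoreVertex : ∀ {m W W' r B} (z : V) → (∀ {x} → x ∈ₛ W → x ≢ z → x ∈ₛ W') →
    LabelledCover G m W r B → LabelledCover G m W' r (restoreBound r B)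
  restoreVertex = RestoreVertex.cover

  restoreVertices : ∀ {m r B} n W → ∣ W ∣ ≤ n → LabelledCover G m W r B →
    LabelledCover G m ⊥ r (iterate (restoreBound r) B n)
  restoreVertices {m} {r} {B} n W ∣W∣≤n c with nonempty? W
  ... | no W-empty = subst (λ W → LabelledCover G m W r _) (Empty-unique W-empty)
                       (LabelledCover-mono G c (≤-iterate (B≤restoreBound r) B n))
  restoreVertices zero W ∣W∣≤0 c | yes (z , z∈W) = ⊥-elim (n≮0 (<-≤-trans (x∈p⇒∣p-x∣<∣p∣ z∈W) ∣W∣≤0))
  restoreVertices (suc n) W ∣W∣≤1+n c | yes (z , z∈W) =
    restoreVertices n (W - z) (≤-pred (<-≤-trans (x∈p⇒∣p-x∣<∣p∣ z∈W) ∣W∣≤1+n))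
      (restoreVertex z x∈p∧x≢y⇒x∈p-y c)

-- IsControlFn m D G unfolds to ∀ r → ControlCover m r (D r) G.
ControlCover : ℕ → ℕ → ℕ → Graph → Set
ControlCover m r B G = Σ (Fin (suc m) → List (Subset (size G))) λ fam →
    (∀ v → ∃[ i ] ∃[ S ] (S ∈ fam i × v ∈ₛ S))
  × (∀ i → Disjoint G r (fam i))
  × (∀ i S → S ∈ fam i → Bounded G B S)

LabelledCover⇒ControlCover : ∀ {G m r B} → LabelledCover G m ⊥ r B → ControlCover m r B G
LabelledCover⇒ControlCover {G} {m} {r} {B} c = family , covers , disjoint , bounded′
  where
  open LabelledCover c

  inPiece? : ∀ i l v → Dec (colour v ≡ i × label v ≡ l)
  inPiece? i l v = (colour v ≟ i) ×-dec List.≡-dec Bool._≟_ (label v) l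

  piece : Fin (suc m) → List Bool → Subset (size G)
  piece i l = select (inPiece? i l)

  family : Fin (suc m) → List (Subset (size G))
  family i = map (λ u → piece i (label u)) (allFin (size G))

  covers : ∀ v → ∃[ i ] ∃[ S ] (S ∈ family i × v ∈ₛ S)
  covers v = colour v , piece (colour v) (label v)
           , ∈-map⁺ (λ u → piece (colour v) (label u)) (∈-allFin v)
           , ∈-select⁺ (inPiece? _ _) (refl , refl)

  disjoint : ∀ i → Disjoint G r (family i)
  disjoint i S T S∈ T∈ S≢T a b a∈S b∈T ab
    with ∈-map⁻ (λ u → piece i (label u)) S∈ | ∈-map⁻ (λ u → piece i (label u)) T∈
  ... | _ , _ , refl | _ , _ , refl
    with ∈-select⁻ (inPiece? i _) a∈S | ∈-select⁻ (inPiece? i _) b∈T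
       | List.≡-dec Bool._≟_ (label a) (label b)
  ... | ca , la | cb , lb | yes la≡lb = S≢T (cong (piece i) (trans (sym la) (trans la≡lb lb)))
  ... | ca , la | cb , lb | no la≢lb = separated a b ∉⊥ ∉⊥ (trans ca (sym cb)) la≢lb (DistLE⇒Reach G ab)

  bounded′ : ∀ i S → S ∈ family i → Bounded G B S
  bounded′ i S S∈ a b a∈S b∈S with ∈-map⁻ (λ u → piece i (label u)) S∈
  ... | _ , _ , refl with ∈-select⁻ (inPiece? i _) a∈S | ∈-select⁻ (inPiece? i _) b∈S
  ... | ca , la | cb , lb = bounded a b ∉⊥ ∉⊥ (trans ca (sym cb)) (trans la (sym lb))

DistLE-induced : ∀ {G k} {e : Fin k → Fin (size G)} {i j l} →
  DistLE (Induced G e) i j l → DistLE G (e i) (e j) l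
DistLE-induced (l , l≤ , walk) = l , l≤ , embed walk
  where
  embed : ∀ {G k} {e : Fin k → Fin (size G)} {i j l} → Walk (Induced G e) i j l → Walk G (e i) (e j) l
  embed here = here
  embed (step ij walk) = step ij (embed walk)

ControlCover⇒LabelledCover : ∀ {G Z k} {e : Fin k → Fin (size G)} →
  (∀ i j → i Fin.< j → e i Fin.< e j) → (∀ v → (v ∉ₛ Z) ⇔ (∃[ i ] e i ≡ v)) →
  ∀ {m r B} → ControlCover m r B (Induced G e) → LabelledCover G m Z r B
ControlCover⇒LabelledCover {G} {Z} {k} {e} increasing image {m} {r} {B}
                           (family , covers , disjoint , bounded′) =
  record { colour = colour ; label = label ; separated = separated ; bounded = bounded }
  where
  H = Induced G e

  pieceColour : Fin k → Fin (suc m)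
  pieceColour i = proj₁ (covers i)

  pieceOf : Fin k → Subset k
  pieceOf i = proj₁ (proj₂ (covers i))

  pieceOf∈family : ∀ i → pieceOf i ∈ family (pieceColour i)
  pieceOf∈family i = proj₁ (proj₂ (proj₂ (covers i)))

  ∈pieceOf : ∀ i → i ∈ₛ pieceOf i
  ∈pieceOf i = proj₂ (proj₂ (proj₂ (covers i)))

  Preimage : Fin (size G) → Set
  Preimage v = ∃[ i ] e i ≡ v

  colourAt : ∀ {v} → Dec (Preimage v) → Fin (suc m)
  colourAt (yes (i , _)) = pieceColour i
  colourAt (no _) = zero

  -- Vertices of Z get a junk colour and label; a cover of G − Z never looks at them.
  labelAt : ∀ {v} → Dec (Preimage v) → List Bool
  labelAt (yes (i , _)) = toList (pieceOf i)
  labelAt (no _) = []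

  preimage? : ∀ v → Dec (Preimage v)
  preimage? v = any? λ i → e i ≟ v

  colour : Fin (size G) → Fin (suc m)
  colour v = colourAt (preimage? v)

  label : Fin (size G) → List Bool
  label v = labelAt (preimage? v)

  injective : ∀ {i j} → e i ≡ e j → i ≡ j
  injective = strictlyIncreasing⇒injective increasing

  atPreimage : ∀ i (d : Dec (Preimage (e i))) →
    colourAt d ≡ pieceColour i × labelAt d ≡ toList (pieceOf i)
  atPreimage i (yes (j , ej≡ei)) with injective ej≡ei
  ... | refl = refl , refl
  atPreimage i (no ¬pre) = ⊥-elim (¬pre (i , refl))

  colour∘e : ∀ i → colour (e i) ≡ pieceColour i
  colour∘e i = proj₁ (atPreimage i (preimage? (e i)))

  label∘e : ∀ i → label (e i) ≡ toList (pieceOf i)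
  label∘e i = proj₂ (atPreimage i (preimage? (e i)))

  reach-induced : ∀ {u v l i j} → Reach G Z u v l → e i ≡ u → e j ≡ v → DistLE H i j l
  reach-induced stop refl ej≡ei with injective ej≡ei
  ... | refl = 0 , z≤n , here
  reach-induced (hop {w = w} uw w∉Z wv) refl ej≡v with Equivalence.to (image w) w∉Z
  ... | _ , refl = DistLE-step H uw (reach-induced wv refl ej≡v)

  separated : ∀ a b → a ∉ₛ Z → b ∉ₛ Z → colour a ≡ colour b → label a ≢ label b → ¬ Reach G Z a b r
  separated a b a∉Z b∉Z ca≡cb la≢lb ab with Equivalence.to (image a) a∉Z | Equivalence.to (image b) b∉Z
  ... | i , refl | j , refl =
    disjoint (pieceColour i) (pieceOf i) (pieceOf j) (pieceOf∈family i)
      (subst (λ c → pieceOf j ∈ family c) (sym ci≡cj) (pieceOf∈family j))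
      (λ pi≡pj → la≢lb (trans (label∘e i) (trans (cong toList pi≡pj) (sym (label∘e j)))))
      i j (∈pieceOf i) (∈pieceOf j) (reach-induced ab refl refl)
    where
    ci≡cj : pieceColour i ≡ pieceColour j
    ci≡cj = trans (sym (colour∘e i)) (trans ca≡cb (colour∘e j))

  bounded : ∀ a b → a ∉ₛ Z → b ∉ₛ Z → colour a ≡ colour b → label a ≡ label b → DistLE G a b B
  bounded a b a∉Z b∉Z _ la≡lb with Equivalence.to (image a) a∉Z | Equivalence.to (image b) b∉Z
  ... | i , refl | j , refl =
    DistLE-induced (bounded′ (pieceColour i) (pieceOf i) (pieceOf∈family i) i j (∈pieceOf i)
                      (subst (j ∈ₛ_) (sym pi≡pj) (∈pieceOf j)))
    where
    pi≡pj : pieceOf i ≡ pieceOf j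
    pi≡pj = toList-injectiveₙ (pieceOf i) (pieceOf j) (trans (sym (label∘e i)) (trans la≡lb (label∘e j)))

-- G − ∅ is G itself: Induced G id is G up to η for records.
⊆Plus : ∀ {𝓕} n {G} → 𝓕 G → Plus 𝓕 n G
⊆Plus n {G} G∈𝓕 =
  ⊥ , subst (_≤ n) (sym (∣⊥∣≡0 (size G))) z≤n , size G , (λ v → v) , (λ _ _ i<j → i<j)
  , (λ v → mk⇔ (λ _ → v , refl) (λ _ → ∉⊥)) , G∈𝓕

AsdimLE-antitone : ∀ {𝓕 𝓖 m} → (∀ G → 𝓕 G → 𝓖 G) → AsdimLE 𝓖 m → AsdimLE 𝓕 m
AsdimLE-antitone 𝓕⊆𝓖 (D , control) = D , λ G G∈𝓕 → control G (𝓕⊆𝓖 G G∈𝓕)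

AsdimLE-Plus : ∀ {𝓕 m} n → AsdimLE 𝓕 m → AsdimLE (Plus 𝓕 n) m
AsdimLE-Plus n (D , control) = (λ r → iterate (restoreBound r) (D r) n) , λ where
  G (Z , ∣Z∣≤n , _ , _ , increasing , image , G-Z∈𝓕) r →
    LabelledCover⇒ControlCover
      (restoreVertices n Z ∣Z∣≤n (ControlCover⇒LabelledCover increasing image (control _ G-Z∈𝓕 r)))

theorem1p8 : (𝓕 : GraphClass) (n : ℕ) → ∀ m → AsdimLE (Plus 𝓕 n) m ⇔ AsdimLE 𝓕 m
theorem1p8 𝓕 n m = mk⇔ (AsdimLE-antitone (λ _ → ⊆Plus {𝓕} n)) (AsdimLE-Plus n)
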